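{- Let $T$ be a finite rooted ordered tree and let $T^*$ be its dual tree. Then $$\mathrm{BP}(T)=\overleftrightarrow{\mathrm{DFUDS}(T^*)},$$ where for a bitvector $B\in\{0,1\}^n$ the reversal $\overleftrightarrow{B}$ is defined by $\overleftrightarrow{B}[x]:=1-B[n-x+1]$ for all $x\in\{1,\ldots,n\}$.
   Context: Trees are finite, rooted and ordered (the children of each node are linearly ordered from left to right). Depth-first traversal order (preorder) visits a node before its descendants and visits children from left to right. For a node $u$, $rmc_T(u)$ is its rightmost child in $T$ and $ils_T(u)$ its immediate left sibling in $T$ (when these exist). Dual tree: for a tree $T$ with root $r$, $T^*$ has the same vertex set and root $r$; parents $\mathsf{pa}^*$ and the order among children in $T^*$ are determined by: (1a) $r$ has no parent in $T^*$; (1b) if $v=rmc_T(r)$ then $v=rmc_{T^*}(r)$; (2) if $v=rmc_T(u)$ with $u\ne r$, then $v$ is the immediate left sibling of $u$ in $T^*$ (so $\mathsf{pa}^*(v)=\mathsf{pa}^*(u)$); (3) if $v=ils_T(u)$, then $v$ is the rightmost child of $u$ in $T^*$ (so $\mathsf{pa}^*(v)=u$). $T^*$ is a rooted ordered tree. Parenthesis representations, written as bitvectors with '(' $=1$ and ')' $=0$: $\mathrm{BP}(T)$ is obtained by a depth-first traversal writing '(' when a node is reached for the first time and ')' when it is left (after all its descendants). $\mathrm{DFUDS}(T)$ is a single '(' followed by the concatenation, over all nodes in depth-first order, of $d$ copies of '(' and then one ')', where $d$ is the number of children of the node. -}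

module Defs where

open import Data.Bool using (Bool; true; false; not)
open import Data.List using (List; []; _∷_; _++_; [_]; map; reverse; replicate; length; concatMap; _∷ʳ_)
open import Data.List.Membership.Propositional using (_∈_)
open import Data.List.Relation.Unary.Unique.Propositional using (Unique)
open import Data.Product using (Σ; ∃; _×_; _,_)
open import Relation.Binary.PropositionalEquality using (_≡_; _≢_)
open import Function.Bundles using (_⇔_)

-- Finite rooted ordered trees whose vertices are named by elements of A.
-- The list of children is ordered from left to right.
data Tree (A : Set) : Set where
  node : A → List (Tree A) → Tree A

module _ {A : Set} where

  root : Tree A → A
  root (node a _) = a

  children : Tree A → List (Tree A)
  children (node _ cs) = cs

  preorder : Tree A → List A
  preorderF : List (Tree A) → List A
  preorder (node a cs) = a ∷ preorderF cs
  preorderF [] = []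
  preorderF (t ∷ ts) = preorder t ++ preorderF ts

  WellNamed : Tree A → Set
  WellNamed t = Unique (preorder t)

  data Sub (s : Tree A) : Tree A → Set where
    here  : Sub s s
    there : ∀ {a cs c} → c ∈ cs → Sub s c → Sub s (node a cs)

  Rmc : Tree A → A → A → Set
  Rmc t u v = Σ (List (Tree A)) λ xs → Σ (Tree A) λ c →
              Sub (node u (xs ∷ʳ c)) t × root c ≡ v

  Ils : Tree A → A → A → Set
  Ils t u v = Σ A λ p → Σ (List (Tree A)) λ xs → Σ (Tree A) λ a →
              Σ (Tree A) λ b → Σ (List (Tree A)) λ ys →
              Sub (node p (xs ++ a ∷ b ∷ ys)) t × root a ≡ v × root b ≡ u

  record IsDual (T S : Tree A) : Set where
    field
      sameVertices : ∀ v → (v ∈ preorder T) ⇔ (v ∈ preorder S)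
      sameRoot     : root S ≡ root T          -- together with uniqueness of names this gives (1a)
      rule1b       : ∀ v → Rmc T (root T) v → Rmc S (root T) v
      rule2        : ∀ u v → Rmc T u v → u ≢ root T → Ils S u v
      rule3        : ∀ u v → Ils T u v → Rmc S u v

-- bitvectors: '(' = true = 1, ')' = false = 0
Bits : Set
Bits = List Bool

module _ {A : Set} where

  BP : Tree A → Bits
  BPF : List (Tree A) → Bits
  BP (node _ cs) = true ∷ BPF cs ++ [ false ]
  BPF [] = []
  BPF (t ∷ ts) = BP t ++ BPF ts

  dfudsBody : Tree A → Bits
  dfudsBodyF : List (Tree A) → Bits
  dfudsBody (node _ cs) = replicate (length cs) true ++ false ∷ dfudsBodyF cs
  dfudsBodyF [] = []
  dfudsBodyF (t ∷ ts) = dfudsBody t ++ dfudsBodyF ts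

  DFUDS : Tree A → Bits
  DFUDS t = true ∷ dfudsBody t

rev : Bits → Bits
rev b = map not (reverse b)

-- Encode a forest as a binary tree whose left child is the rightmost child and whose right
-- child is the immediate left sibling.  The rules defining T* say precisely that the
-- encoding of the children of the root of T* is the mirror image of that of T: both trees
-- have unique labels, every parent–child edge of the mirror is an edge of the encoding of
-- T*, the roots agree, and both have the same number of vertices, so they coincide.
-- Reading BP off the encoding of T and reversing it yields DFUDS read off its mirror.
module Submission where

open import Defs
open import Data.Bool using (true; false; not)
open import Data.Bool.Properties using (not-involutive)
open import Data.Empty using (⊥-elim)
open import Data.List using (List; []; _∷_; _++_; [_]; _∷ʳ_; map; reverse; replicate; length)
open import Data.List.Properties
  using (++-assoc; ++-identityʳ; length-++; map-++; map-∘; map-id; map-cong;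
         reverse-++; reverse-map; reverse-involutive)
open import Data.List.Reverse using (reverseView; _∶_∶ʳ_)
open import Data.List.Membership.Propositional using (_∈_; _∉_)
open import Data.List.Membership.Propositional.Properties using (∈-++⁺ˡ; ∈-++⁺ʳ; ∈-∃++)
open import Data.List.Membership.Propositional.Properties.WithK using (unique∧set⇒bag)
open import Data.List.Relation.Binary.BagAndSetEquality using (∼bag⇒↭)
open import Data.List.Relation.Binary.Permutation.Propositional.Properties using (↭-length)
open import Data.List.Relation.Unary.Any using (here; there)
open import Data.List.Relation.Unary.All as All using ()
open import Data.List.Relation.Unary.All.Properties using (++⁻ˡ; ++⁻ʳ)
open import Data.List.Relation.Unary.AllPairs as AllPairs using ([]; _∷_)
open import Data.List.Relation.Unary.Unique.Propositional using (Unique)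
open import Data.List.Relation.Unary.Unique.Propositional.Properties using (Unique[x∷xs]⇒x∉xs)
open import Data.Nat using (ℕ; suc; _+_; _≤_; z≤n; s≤s)
open import Data.Nat.Properties
  using (suc-injective; +-suc; +-comm; +-cancelˡ-≡; +-mono-≤; +-mono-<-≤; <⇒≢; m≤n⇒m<n∨m≡n)
open import Data.Product using (∃; ∃₂; _×_; _,_; proj₂)
open import Data.Sum using (_⊎_; inj₁; inj₂)
open import Function using (_∘_)
open import Function.Bundles using (_⇔_)
open import Relation.Nullary using (contradiction)
open import Relation.Binary.PropositionalEquality
  using (_≡_; _≢_; refl; sym; trans; cong; cong₂; subst; subst₂; module ≡-Reasoning)
open ≡-Reasoning

rev-++ : ∀ xs ys → rev (xs ++ ys) ≡ rev ys ++ rev xs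
rev-++ xs ys = trans (cong (map not) (reverse-++ xs ys)) (map-++ not (reverse ys) (reverse xs))

rev-involutive : ∀ b → rev (rev b) ≡ b
rev-involutive b = begin
  map not (reverse (map not (reverse b)))  ≡⟨ cong (map not) (sym (reverse-map not (reverse b))) ⟩
  map not (map not (reverse (reverse b)))  ≡⟨ sym (map-∘ (reverse (reverse b))) ⟩
  map (not ∘ not) (reverse (reverse b))    ≡⟨ map-cong not-involutive (reverse (reverse b)) ⟩
  map (λ x → x) (reverse (reverse b))      ≡⟨ map-id (reverse (reverse b)) ⟩
  reverse (reverse b)                      ≡⟨ reverse-involutive b ⟩
  b                                        ∎

rev-bracket : ∀ b → rev (true ∷ b ++ [ false ]) ≡ true ∷ rev b ++ [ false ]
rev-bracket b = trans (rev-++ [ true ] (b ++ [ false ])) (cong (_++ [ false ]) (rev-++ b [ false ]))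

≤-+-≡⇒≡ : ∀ {m m′ n n′} → m ≤ m′ → n ≤ n′ → m + n ≡ m′ + n′ → m ≡ m′ × n ≡ n′
≤-+-≡⇒≡ {m} m≤m′ n≤n′ eq with m≤n⇒m<n∨m≡n m≤m′
... | inj₁ m<m′ = contradiction eq (<⇒≢ (+-mono-<-≤ m<m′ n≤n′))
... | inj₂ refl = refl , +-cancelˡ-≡ m _ _ eq

Unique-++⁻ : ∀ {A : Set} (xs : List A) {ys} → Unique (xs ++ ys) →
             Unique xs × Unique ys × (∀ {x} → x ∈ xs → x ∉ ys)
Unique-++⁻ []       u = [] , u , λ ()
Unique-++⁻ (x ∷ xs) {ys} (x≢ ∷ u) with Unique-++⁻ xs u
... | uxs , uys , xs#ys = ++⁻ˡ xs x≢ ∷ uxs , uys , x∷xs#ys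
  where
    x∷xs#ys : ∀ {z} → z ∈ x ∷ xs → z ∉ ys
    x∷xs#ys (here refl) z∈ys = All.lookup (++⁻ʳ xs x≢) z∈ys refl
    x∷xs#ys (there z∈xs)    = xs#ys z∈xs

data Bin (A : Set) : Set where
  leaf : Bin A
  fork : A → Bin A → Bin A → Bin A

module _ {A : Set} where

  mirror : Bin A → Bin A
  mirror leaf         = leaf
  mirror (fork a L R) = fork a (mirror R) (mirror L)

  mirror-involutive : ∀ t → mirror (mirror t) ≡ t
  mirror-involutive leaf         = refl
  mirror-involutive (fork a L R) = cong₂ (fork a) (mirror-involutive L) (mirror-involutive R)

  labels : Bin A → List A
  labels leaf         = []
  labels (fork a L R) = labels R ++ a ∷ labels L

  size : Bin A → ℕ
  size leaf         = 0
  size (fork _ L R) = suc (size L + size R)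

  length-labels : ∀ t → length (labels t) ≡ size t
  length-labels leaf         = refl
  length-labels (fork a L R) = begin
    length (labels R ++ a ∷ labels L)            ≡⟨ length-++ (labels R) ⟩
    length (labels R) + suc (length (labels L))  ≡⟨ cong₂ (λ m n → m + suc n) (length-labels R) (length-labels L) ⟩
    size R + suc (size L)                        ≡⟨ +-suc (size R) (size L) ⟩
    suc (size R + size L)                        ≡⟨ cong suc (+-comm (size R) (size L)) ⟩
    suc (size L + size R)                        ∎

  size-mirror : ∀ t → size (mirror t) ≡ size t
  size-mirror leaf         = refl
  size-mirror (fork a L R) =
    cong suc (trans (cong₂ _+_ (size-mirror R) (size-mirror L)) (+-comm (size R) (size L)))

  infix 4 _⊑_ _≼_

  data _⊑_ (s : Bin A) : Bin A → Set where
    here  : s ⊑ s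
    left  : ∀ {a L R} → s ⊑ L → s ⊑ fork a L R
    right : ∀ {a L R} → s ⊑ R → s ⊑ fork a L R

  ⊑-trans : ∀ {s t u} → s ⊑ t → t ⊑ u → s ⊑ u
  ⊑-trans p here      = p
  ⊑-trans p (left q)  = left (⊑-trans p q)
  ⊑-trans p (right q) = right (⊑-trans p q)

  left-⊑ : ∀ {a L R t} → fork a L R ⊑ t → L ⊑ t
  left-⊑ = ⊑-trans (left here)

  right-⊑ : ∀ {a L R t} → fork a L R ⊑ t → R ⊑ t
  right-⊑ = ⊑-trans (right here)

  ⊑-mirror : ∀ {s t} → s ⊑ t → mirror s ⊑ mirror t
  ⊑-mirror here      = here
  ⊑-mirror (left p)  = right (⊑-mirror p)
  ⊑-mirror (right p) = left (⊑-mirror p)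

  ⊑-mirror⁻ : ∀ {s t} → s ⊑ mirror t → mirror s ⊑ t
  ⊑-mirror⁻ {t = t} p = subst (_ ⊑_) (mirror-involutive t) (⊑-mirror p)

  ⊑-root∈labels : ∀ {a L R t} → fork a L R ⊑ t → a ∈ labels t
  ⊑-root∈labels {R = R} here        = ∈-++⁺ʳ (labels R) (here refl)
  ⊑-root∈labels (left {R = R′} p)   = ∈-++⁺ʳ (labels R′) (there (⊑-root∈labels p))
  ⊑-root∈labels (right p)           = ∈-++⁺ˡ (⊑-root∈labels p)

  ⊑-root-unique : ∀ {t a L R L′ R′} → Unique (labels t) →
                  fork a L R ⊑ t → fork a L′ R′ ⊑ t → fork a L R ≡ fork a L′ R′
  ⊑-root-unique {fork y TL TR} u p q with Unique-++⁻ (labels TR) u | p | q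
  ... | _        , _        , _     | here     | here     = refl
  ... | _        , uyL      , _     | here     | left q′  = ⊥-elim (Unique[x∷xs]⇒x∉xs uyL (⊑-root∈labels q′))
  ... | _        , uyL      , _     | left p′  | here     = ⊥-elim (Unique[x∷xs]⇒x∉xs uyL (⊑-root∈labels p′))
  ... | _        , _        , R#yL  | here     | right q′ = ⊥-elim (R#yL (⊑-root∈labels q′) (here refl))
  ... | _        , _        , R#yL  | right p′ | here     = ⊥-elim (R#yL (⊑-root∈labels p′) (here refl))
  ... | _        , _        , R#yL  | left p′  | right q′ = ⊥-elim (R#yL (⊑-root∈labels q′) (there (⊑-root∈labels p′)))
  ... | _        , _        , R#yL  | right p′ | left q′  = ⊥-elim (R#yL (⊑-root∈labels p′) (there (⊑-root∈labels q′)))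
  ... | _        , _ ∷ uL   , _     | left p′  | left q′  = ⊑-root-unique uL p′ q′
  ... | uR       , _        , _     | right p′ | right q′ = ⊑-root-unique uR p′ q′

  data _≼_ : Bin A → Bin A → Set where
    leaf≼ : ∀ {t} → leaf ≼ t
    fork≼ : ∀ {a L R L′ R′} → L ≼ L′ → R ≼ R′ → fork a L R ≼ fork a L′ R′

  ≼-size : ∀ {s t} → s ≼ t → size s ≤ size t
  ≼-size leaf≼       = z≤n
  ≼-size (fork≼ p q) = s≤s (+-mono-≤ (≼-size p) (≼-size q))

  ≼∧size≡⇒≡ : ∀ {s t} → s ≼ t → size s ≡ size t → s ≡ t
  ≼∧size≡⇒≡ {t = leaf}       leaf≼ _  = refl
  ≼∧size≡⇒≡ {t = fork _ _ _} leaf≼ ()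
  ≼∧size≡⇒≡ (fork≼ p q) eq with ≤-+-≡⇒≡ (≼-size p) (≼-size q) (suc-injective eq)
  ... | eqL , eqR with ≼∧size≡⇒≡ p eqL | ≼∧size≡⇒≡ q eqR
  ...   | refl | refl = refl

  data RootFits : Bin A → Bin A → Set where
    leaf-fits : ∀ {t} → RootFits leaf t
    fork-fits : ∀ {a L R L′ R′} → RootFits (fork a L R) (fork a L′ R′)

  data LeftChild (t : Bin A) (u v : A) : Set where
    leftChild : ∀ {L R R′} → fork u (fork v L R) R′ ⊑ t → LeftChild t u v

  data RightChild (t : Bin A) (u v : A) : Set where
    rightChild : ∀ {L L′ R} → fork u L′ (fork v L R) ⊑ t → RightChild t u v

  LeftChild-mirror : ∀ {t u v} → LeftChild (mirror t) u v → RightChild t u v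
  LeftChild-mirror (leftChild p) = rightChild (⊑-mirror⁻ p)

  RightChild-mirror : ∀ {t u v} → RightChild (mirror t) u v → LeftChild t u v
  RightChild-mirror (rightChild p) = leftChild (⊑-mirror⁻ p)

  module _ {M Y : Bin A} (uniqueY : Unique (labels Y))
           (keepsLeft  : ∀ {u v} → LeftChild M u v → LeftChild Y u v)
           (keepsRight : ∀ {u v} → RightChild M u v → RightChild Y u v) where

    private
      leftFits : ∀ {a L R L′ R′} → fork a L R ⊑ M → fork a L′ R′ ⊑ Y → RootFits L L′
      leftFits {L = leaf}       _ _ = leaf-fits
      leftFits {L = fork _ _ _} p q with keepsLeft (leftChild p)
      ... | leftChild p′ with ⊑-root-unique uniqueY p′ q
      ...   | refl = fork-fits

      rightFits : ∀ {a L R L′ R′} → fork a L R ⊑ M → fork a L′ R′ ⊑ Y → RootFits R R′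
      rightFits {R = leaf}       _ _ = leaf-fits
      rightFits {R = fork _ _ _} p q with keepsRight (rightChild p)
      ... | rightChild p′ with ⊑-root-unique uniqueY p′ q
      ...   | refl = fork-fits

      ≼-from-children : ∀ {s t} → s ⊑ M → t ⊑ Y → RootFits s t → s ≼ t
      ≼-from-children _ _ leaf-fits = leaf≼
      ≼-from-children p q fork-fits =
        fork≼ (≼-from-children (left-⊑ p) (left-⊑ q) (leftFits p q))
              (≼-from-children (right-⊑ p) (right-⊑ q) (rightFits p q))

    ≡-from-children : RootFits M Y → size M ≡ size Y → M ≡ Y
    ≡-from-children fits = ≼∧size≡⇒≡ (≼-from-children here here fits)

module _ {A : Set} where

  encodeFrom : Bin A → List (Tree A) → Bin A
  encode     : List (Tree A) → Bin A
  encodeFrom acc []                = acc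
  encodeFrom acc (node a ds ∷ ts) = encodeFrom (fork a (encode ds) acc) ts
  encode cs = encodeFrom leaf cs

  encodeFrom-++ : ∀ acc xs ys → encodeFrom acc (xs ++ ys) ≡ encodeFrom (encodeFrom acc xs) ys
  encodeFrom-++ acc []                ys = refl
  encodeFrom-++ acc (node a ds ∷ xs) ys = encodeFrom-++ (fork a (encode ds) acc) xs ys

  encode-∷ʳ : ∀ xs a ds → encode (xs ∷ʳ node a ds) ≡ fork a (encode ds) (encode xs)
  encode-∷ʳ xs a ds = encodeFrom-++ leaf xs [ node a ds ]

  encode≡fork⇒∷ʳ : ∀ xs {v L R} → encode xs ≡ fork v L R →
                   ∃₂ λ ys es → xs ≡ ys ∷ʳ node v es × L ≡ encode es × R ≡ encode ys
  encode≡fork⇒∷ʳ xs eq with reverseView xs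
  ... | ys ∶ _ ∶ʳ node w es with trans (sym (encode-∷ʳ ys w es)) eq
  ...   | refl = ys , es , refl , refl , refl

  labels-encodeFrom : ∀ acc cs → labels (encodeFrom acc cs) ≡ labels acc ++ preorderF cs
  labels-encodeFrom acc []                = sym (++-identityʳ _)
  labels-encodeFrom acc (node a ds ∷ ts) = begin
    labels (encodeFrom (fork a (encode ds) acc) ts)          ≡⟨ labels-encodeFrom _ ts ⟩
    (labels acc ++ a ∷ labels (encode ds)) ++ preorderF ts   ≡⟨ cong (λ l → (labels acc ++ a ∷ l) ++ preorderF ts)
                                                                     (labels-encodeFrom leaf ds) ⟩
    (labels acc ++ a ∷ preorderF ds) ++ preorderF ts         ≡⟨ ++-assoc (labels acc) _ _ ⟩
    labels acc ++ preorderF (node a ds ∷ ts)                 ∎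

  labels-encode : ∀ cs → labels (encode cs) ≡ preorderF cs
  labels-encode = labels-encodeFrom leaf

  size-encode : ∀ cs → size (encode cs) ≡ length (preorderF cs)
  size-encode cs = trans (sym (length-labels (encode cs))) (cong length (labels-encode cs))

  Sub-trans : ∀ {s t w : Tree A} → Sub s t → Sub t w → Sub s w
  Sub-trans p here        = p
  Sub-trans p (there m q) = there m (Sub-trans p q)

  ⊑-encodeFrom : ∀ acc cs → acc ⊑ encodeFrom acc cs
  ⊑-encodeFrom acc []                = here
  ⊑-encodeFrom acc (node a ds ∷ ts) = right-⊑ (⊑-encodeFrom (fork a (encode ds) acc) ts)

  encode-split : ∀ xs u ds zs → fork u (encode ds) (encode xs) ⊑ encode (xs ++ node u ds ∷ zs)
  encode-split xs u ds zs =
    subst (_ ⊑_) (sym (encodeFrom-++ leaf xs (node u ds ∷ zs))) (⊑-encodeFrom _ zs)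

  ∈⇒fork⊑encode : ∀ {u ds cs} → node u ds ∈ cs → ∃ λ R → fork u (encode ds) R ⊑ encode cs
  ∈⇒fork⊑encode m with ∈-∃++ m
  ... | xs , zs , refl = encode xs , encode-split xs _ _ zs

  Sub⇒fork⊑encode : ∀ {u ds c cs} → c ∈ cs → Sub (node u ds) c →
                    ∃ λ R → fork u (encode ds) R ⊑ encode cs
  Sub⇒fork⊑encode c∈cs here = ∈⇒fork⊑encode c∈cs
  Sub⇒fork⊑encode c∈cs (there c′∈cs′ sub) with Sub⇒fork⊑encode c′∈cs′ sub | ∈⇒fork⊑encode c∈cs
  ... | R , p | _ , q = R , ⊑-trans p (left-⊑ q)

  Sub⇒encode⊑encode : ∀ {p fs q gs} → Sub (node p fs) (node q gs) → encode fs ⊑ encode gs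
  Sub⇒encode⊑encode here               = here
  Sub⇒encode⊑encode (there c∈gs sub) = left-⊑ (proj₂ (Sub⇒fork⊑encode c∈gs sub))

  data Position (t : Tree A) (u : A) (L R : Bin A) : Set where
    position : ∀ p xs ds zs → Sub (node p (xs ++ node u ds ∷ zs)) t →
               L ≡ encode ds → R ≡ encode xs → Position t u L R

  -- ps are the left siblings already folded into the accumulator.
  ⊑-encodeFrom⁻ : ∀ {u L R} p ps cs → fork u L R ⊑ encodeFrom (encode ps) cs →
                  fork u L R ⊑ encode ps ⊎ Position (node p (ps ++ cs)) u L R
  ⊑-encodeFrom⁻ p ps [] q = inj₁ q
  ⊑-encodeFrom⁻ p ps (node a ds ∷ ts) q
    with ⊑-encodeFrom⁻ p (ps ∷ʳ node a ds) ts (subst (λ b → _ ⊑ encodeFrom b ts) (sym (encode-∷ʳ ps a ds)) q)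
  ... | inj₂ pos = inj₂ (subst (λ cs → Position (node p cs) _ _ _) (++-assoc ps [ node a ds ] ts) pos)
  ... | inj₁ q′ with subst (_ ⊑_) (encode-∷ʳ ps a ds) q′
  ...   | here     = inj₂ (position p ps ds ts here refl refl)
  ...   | right q″ = inj₁ q″
  ...   | left q″ with ⊑-encodeFrom⁻ a [] ds q″
  ...     | inj₂ (position p′ xs es zs sub eqL eqR) =
              inj₂ (position p′ xs es zs (Sub-trans sub (there (∈-++⁺ʳ ps (here refl)) here)) eqL eqR)

  ⊑-encode⇒Position : ∀ {u L R} p cs → fork u L R ⊑ encode cs → Position (node p cs) u L R
  ⊑-encode⇒Position p cs q with ⊑-encodeFrom⁻ p [] cs q
  ... | inj₂ pos = pos

  LeftChild⇒Rmc : ∀ {r cs u v} → LeftChild (encode cs) u v → Rmc (node r cs) u v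
  LeftChild⇒Rmc {r} {cs} (leftChild q) with ⊑-encode⇒Position r cs q
  ... | position p xs ds zs sub eqL _ with encode≡fork⇒∷ʳ ds (sym eqL)
  ...   | ys , es , refl , _ = ys , node _ es , Sub-trans (there (∈-++⁺ʳ xs (here refl)) here) sub , refl

  RightChild⇒Ils : ∀ {r cs u v} → RightChild (encode cs) u v → Ils (node r cs) u v
  RightChild⇒Ils {r} {cs} (rightChild q) with ⊑-encode⇒Position r cs q
  ... | position p xs ds zs sub _ eqR with encode≡fork⇒∷ʳ xs (sym eqR)
  ...   | ys , es , refl , _ =
    p , ys , node _ es , node _ ds , zs ,
    subst (λ cs′ → Sub (node p cs′) _) (++-assoc ys [ node _ es ] (node _ ds ∷ zs)) sub , refl , refl

  Rmc⇒LeftChild : ∀ {r cs u v} → Rmc (node r cs) u v → u ≢ r → LeftChild (encode cs) u v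
  Rmc⇒LeftChild (_ , _ , here , _) u≢r = ⊥-elim (u≢r refl)
  Rmc⇒LeftChild (xs , node w es , there c∈cs sub , refl) _ with Sub⇒fork⊑encode c∈cs sub
  ... | R , q = leftChild (subst (λ L → fork _ L R ⊑ _) (encode-∷ʳ xs w es) q)

  Ils⇒RightChild : ∀ {r cs u v} → Ils (node r cs) u v → RightChild (encode cs) u v
  Ils⇒RightChild (p , xs , node w es , node u ds , ys , sub , refl , refl) =
    rightChild (⊑-trans (subst₂ _⊑_ (cong (λ R → fork u (encode ds) R) (encode-∷ʳ xs w es))
                                     (cong encode (++-assoc xs [ node w es ] (node u ds ∷ ys)))
                                     (encode-split (xs ∷ʳ node w es) u ds ys))
                        (Sub⇒encode⊑encode sub))

  encode≡fork⇒Rmc-root : ∀ {r cs v L R} → encode cs ≡ fork v L R → Rmc (node r cs) r v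
  encode≡fork⇒Rmc-root {cs = cs} eq with encode≡fork⇒∷ʳ cs eq
  ... | ys , es , refl , _ = ys , node _ es , here , refl

  Rmc-root⇒encode≡fork : ∀ {r cs v} → r ∉ preorderF cs → Rmc (node r cs) r v →
                         ∃₂ λ L R → encode cs ≡ fork v L R
  Rmc-root⇒encode≡fork _ (xs , node w es , here , refl) = encode es , encode xs , encode-∷ʳ xs w es
  Rmc-root⇒encode≡fork {cs = cs} r∉ (_ , _ , there c∈cs sub , _) =
    ⊥-elim (r∉ (subst (_ ∈_) (labels-encode cs) (⊑-root∈labels (proj₂ (Sub⇒fork⊑encode c∈cs sub)))))

  rightSpine : Bin A → ℕ
  rightSpine leaf         = 0
  rightSpine (fork _ _ R) = suc (rightSpine R)

  bpᵇ : Bin A → Bits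
  bpᵇ leaf         = []
  bpᵇ (fork _ L R) = bpᵇ R ++ true ∷ bpᵇ L ++ [ false ]

  dfudsBodyᵇ : Bin A → Bits
  dfudsBodyᵇ leaf         = []
  dfudsBodyᵇ (fork _ L R) = dfudsBodyᵇ R ++ replicate (rightSpine L) true ++ false ∷ dfudsBodyᵇ L

  dfudsᵇ : Bin A → Bits
  dfudsᵇ t = replicate (rightSpine t) true ++ false ∷ dfudsBodyᵇ t

  rightSpine-encodeFrom : ∀ acc cs → rightSpine (encodeFrom acc cs) ≡ length cs + rightSpine acc
  rightSpine-encodeFrom acc []                = refl
  rightSpine-encodeFrom acc (node a ds ∷ ts) =
    trans (rightSpine-encodeFrom (fork a (encode ds) acc) ts) (+-suc (length ts) (rightSpine acc))

  rightSpine-encode : ∀ cs → rightSpine (encode cs) ≡ length cs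
  rightSpine-encode cs = trans (rightSpine-encodeFrom leaf cs) (+-comm (length cs) 0)

  bpᵇ-encodeFrom : ∀ acc cs → bpᵇ (encodeFrom acc cs) ≡ bpᵇ acc ++ BPF cs
  bpᵇ-encodeFrom acc []                = sym (++-identityʳ _)
  bpᵇ-encodeFrom acc (node a ds ∷ ts) = begin
    bpᵇ (encodeFrom (fork a (encode ds) acc) ts)                    ≡⟨ bpᵇ-encodeFrom _ ts ⟩
    (bpᵇ acc ++ true ∷ bpᵇ (encode ds) ++ [ false ]) ++ BPF ts    ≡⟨ cong (λ b → (bpᵇ acc ++ true ∷ b ++ [ false ]) ++ BPF ts)
                                                                          (bpᵇ-encodeFrom leaf ds) ⟩
    (bpᵇ acc ++ BP (node a ds)) ++ BPF ts                           ≡⟨ ++-assoc (bpᵇ acc) _ _ ⟩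
    bpᵇ acc ++ BPF (node a ds ∷ ts)                                 ∎

  dfudsBodyᵇ-encodeFrom : ∀ acc cs → dfudsBodyᵇ (encodeFrom acc cs) ≡ dfudsBodyᵇ acc ++ dfudsBodyF cs
  dfudsBodyᵇ-encodeFrom acc []                = sym (++-identityʳ _)
  dfudsBodyᵇ-encodeFrom acc (node a ds ∷ ts) = begin
    dfudsBodyᵇ (encodeFrom (fork a (encode ds) acc) ts)       ≡⟨ dfudsBodyᵇ-encodeFrom _ ts ⟩
    (dfudsBodyᵇ acc ++ dfudsᵇ (encode ds)) ++ dfudsBodyF ts  ≡⟨ cong₂ (λ n b → (dfudsBodyᵇ acc ++ replicate n true ++ false ∷ b) ++ dfudsBodyF ts)
                                                                     (rightSpine-encode ds) (dfudsBodyᵇ-encodeFrom leaf ds) ⟩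
    (dfudsBodyᵇ acc ++ dfudsBody (node a ds)) ++ dfudsBodyF ts ≡⟨ ++-assoc (dfudsBodyᵇ acc) _ _ ⟩
    dfudsBodyᵇ acc ++ dfudsBodyF (node a ds ∷ ts)               ∎

  DFUDS-encode : ∀ r cs → DFUDS (node r cs) ≡ true ∷ dfudsᵇ (encode cs)
  DFUDS-encode r cs = cong₂ (λ n b → true ∷ replicate n true ++ false ∷ b)
                            (sym (rightSpine-encode cs)) (sym (dfudsBodyᵇ-encodeFrom leaf cs))

  rev-bpᵇ : ∀ t → rev (bpᵇ t) ++ [ false ] ≡ dfudsᵇ (mirror t)
  rev-bpᵇ leaf         = refl
  rev-bpᵇ (fork a L R) = begin
    rev (bpᵇ R ++ true ∷ bpᵇ L ++ [ false ]) ++ [ false ]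
      ≡⟨ cong (_++ [ false ]) (rev-++ (bpᵇ R) (true ∷ bpᵇ L ++ [ false ])) ⟩
    (rev (true ∷ bpᵇ L ++ [ false ]) ++ rev (bpᵇ R)) ++ [ false ]
      ≡⟨ cong (λ b → (b ++ rev (bpᵇ R)) ++ [ false ]) (rev-bracket (bpᵇ L)) ⟩
    true ∷ ((rev (bpᵇ L) ++ [ false ]) ++ rev (bpᵇ R)) ++ [ false ]
      ≡⟨ cong (true ∷_) (++-assoc (rev (bpᵇ L) ++ [ false ]) (rev (bpᵇ R)) [ false ]) ⟩
    true ∷ (rev (bpᵇ L) ++ [ false ]) ++ (rev (bpᵇ R) ++ [ false ])
      ≡⟨ cong₂ (λ l r → true ∷ l ++ r) (rev-bpᵇ L) (rev-bpᵇ R) ⟩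
    true ∷ dfudsᵇ (mirror L) ++ dfudsᵇ (mirror R)
      ≡⟨ cong (true ∷_) (++-assoc (replicate (rightSpine (mirror L)) true) _ _) ⟩
    dfudsᵇ (mirror (fork a L R))
      ∎

  rev-BP-encode : ∀ r cs → rev (BP (node r cs)) ≡ true ∷ dfudsᵇ (mirror (encode cs))
  rev-BP-encode r cs = begin
    rev (true ∷ BPF cs ++ [ false ])        ≡⟨ rev-bracket (BPF cs) ⟩
    true ∷ rev (BPF cs) ++ [ false ]        ≡⟨ cong (λ b → true ∷ rev b ++ [ false ]) (sym (bpᵇ-encodeFrom leaf cs)) ⟩
    true ∷ rev (bpᵇ (encode cs)) ++ [ false ] ≡⟨ cong (true ∷_) (rev-bpᵇ (encode cs)) ⟩
    true ∷ dfudsᵇ (mirror (encode cs))      ∎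

unique∧sameElements⇒length≡ : ∀ {A : Set} {xs ys : List A} → Unique xs → Unique ys →
                              (∀ v → v ∈ xs ⇔ v ∈ ys) → length xs ≡ length ys
unique∧sameElements⇒length≡ uxs uys same = ↭-length (∼bag⇒↭ (unique∧set⇒bag uxs uys (λ {v} → same v)))

mirror-encode-dual : ∀ {A : Set} {r : A} {csT csS} → WellNamed (node r csT) → WellNamed (node r csS) →
                     IsDual (node r csT) (node r csS) → mirror (encode csT) ≡ encode csS
mirror-encode-dual {r = r} {csT} {csS} wT wS dual =
  ≡-from-children uniqueY keepsLeft keepsRight rootFits sizes
  where
    open IsDual dual

    uniqueY : Unique (labels (encode csS))
    uniqueY = subst Unique (sym (labels-encode csS)) (AllPairs.tail wS)

    nonRoot : ∀ {u L R} → fork u L R ⊑ encode csT → u ≢ r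
    nonRoot q refl = Unique[x∷xs]⇒x∉xs wT (subst (r ∈_) (labels-encode csT) (⊑-root∈labels q))

    keepsLeft : ∀ {u v} → LeftChild (mirror (encode csT)) u v → LeftChild (encode csS) u v
    keepsLeft e with LeftChild-mirror e
    ... | e′@(rightChild q) = Rmc⇒LeftChild (rule3 _ _ (RightChild⇒Ils e′)) (nonRoot q)

    keepsRight : ∀ {u v} → RightChild (mirror (encode csT)) u v → RightChild (encode csS) u v
    keepsRight e with RightChild-mirror e
    ... | e′@(leftChild q) = Ils⇒RightChild (rule2 _ _ (LeftChild⇒Rmc e′) (nonRoot q))

    rootFits : RootFits (mirror (encode csT)) (encode csS)
    rootFits with encode csT in eq
    ... | leaf       = leaf-fits
    ... | fork v _ _ with Rmc-root⇒encode≡fork (Unique[x∷xs]⇒x∉xs wS) (rule1b v (encode≡fork⇒Rmc-root eq))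
    ...   | _ , _ , eqS rewrite eqS = fork-fits

    sizes : size (mirror (encode csT)) ≡ size (encode csS)
    sizes = begin
      size (mirror (encode csT))  ≡⟨ size-mirror (encode csT) ⟩
      size (encode csT)           ≡⟨ size-encode csT ⟩
      length (preorderF csT)      ≡⟨ suc-injective (unique∧sameElements⇒length≡ wT wS sameVertices) ⟩
      length (preorderF csS)      ≡⟨ size-encode csS ⟨
      size (encode csS)           ∎

theorem1 : {A : Set} (T S : Tree A) → WellNamed T → WellNamed S →
    IsDual T S → BP T ≡ rev (DFUDS S)
theorem1 (node r csT) (node _ csS) wT wS dual with IsDual.sameRoot dual
... | refl = begin
  BP (node r csT)                          ≡⟨ rev-involutive (BP (node r csT)) ⟨
  rev (rev (BP (node r csT)))              ≡⟨ cong rev (rev-BP-encode r csT) ⟩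
  rev (true ∷ dfudsᵇ (mirror (encode csT))) ≡⟨ cong (λ t → rev (true ∷ dfudsᵇ t)) (mirror-encode-dual wT wS dual) ⟩
  rev (true ∷ dfudsᵇ (encode csS))         ≡⟨ cong rev (DFUDS-encode r csS) ⟨
  rev (DFUDS (node r csS))                 ∎
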